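{- Let $G$ be a non-complete chordal graph of order $n$ with clique number $d$, let $K_d=\{x_1,\ldots,x_d\}$ be a maximum clique, let $\sigma$ be an admissible PEO for $(G,K_d)$, and let $T=\alpha_\sigma(G)$. Then $T$ is a threshold graph, and $G$ and $T$ have the same clique vector and the same $b$--vector.
   Context: Graphs are finite and simple; chordal means every cycle of length at least $4$ has a chord. A PEO (perfect elimination ordering) is a bijection $\sigma:\{1,\ldots,n\}\to V(G)$ such that each $\sigma(i)$ is simplicial (its neighbourhood is a clique) in the subgraph induced by $\{\sigma(i),\ldots,\sigma(n)\}$. $N_\sigma(v)=\{u\in N(v):\sigma^{ -1}(v)<\sigma^{ -1}(u)\}$, $n_\sigma(v)=|N_\sigma(v)|$, and for a maximal clique $C$, $s(C)=\{x\in C:N_\sigma(x)\not\subseteq C\}$. A PEO $\sigma$ is admissible for $(G,K_d)$ if: (a) every vertex outside $K_d$ precedes every vertex of $K_d$ and $\sigma^{ -1}(x_i)=n-i+1$ for $i=1,\ldots,d$; and for every maximal clique $C$: (b) $\sigma^{ -1}(u)<\sigma^{ -1}(v)$ for all $u\in C\setminus s(C)$, $v\in s(C)$; (c) if $|s(C)|<i\le|C|$ there is a unique $u\in C\setminus s(C)$ with $n_\sigma(u)=i-1$; (d) for every other maximal clique $C'$ with $C\cap C'\ne\emptyset$, either all of $C\setminus C'$ or all of $C'\setminus C$ precede all of $C\cap C'$ in $\sigma$. The graph $\alpha_\sigma(G)$ has vertex set $V(G)$ and edge set $\alpha_\sigma(E(G))$, where $\alpha_\sigma(uv)=uv$ for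 edges inside $K_d$, and for $u\notin K_d$ with $N_\sigma(u)=\{u_1,\ldots,u_{n_\sigma(u)}\}$ listed so that $\sigma^{ -1}(u_1)<\cdots<\sigma^{ -1}(u_{n_\sigma(u)})$, $\alpha_\sigma(uu_i)=ux_i$. A threshold graph is one obtainable from a single vertex by repeatedly adding an isolated vertex or a vertex adjacent to all existing vertices. The clique vector is $(c_1,\ldots,c_d)$ with $c_i$ the number of cliques with $i$ vertices, and the $b$--vector $(b_1,\ldots,b_d)$ is defined by $\sum_i b_i(x+1)^{i-1}=\sum_i c_ix^{i-1}$. -}

module Defs where

open import Data.Nat using (ℕ; zero; suc; _≤_; _<_; _∸_; _≡ᵇ_)
open import Data.Bool as Bool using (Bool; true; false; _∧_; _∨_; not)
open import Data.Fin as Fin using (Fin; toℕ; _≟_)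
open import Data.Fin.Properties using (all?; any?)
open import Data.Fin.Subset using (Subset; _∈_; _∉_; _⊆_; ∣_∣; inside; outside)
open import Data.Fin.Subset.Properties using (_∈?_; _⊆?_)
open import Data.Fin.Permutation using (Permutation′; _⟨$⟩ʳ_; _⟨$⟩ˡ_)
open import Data.Integer as ℤ using (ℤ; +_)
open import Data.Bool.ListAction renaming (any to anyL)
open import Data.List as List using (List; []; _∷_; length; filter; allFin)
open import Data.Vec as Vec using (Vec; []; _∷_; tabulate)
open import Data.Product using (Σ; ∃; ∃!; _×_; _,_)
open import Data.Sum using (_⊎_)
open import Relation.Nullary using (Dec; ¬_; ¬?)
open import Relation.Nullary.Decidable using (⌊_⌋; _→-dec_)
open import Relation.Binary.PropositionalEquality using (_≡_; _≢_)

Adj : ℕ → Set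
Adj n = Fin n → Fin n → Bool

Simple : ∀ {n} → Adj n → Set
Simple {n} adj = (∀ u v → adj u v ≡ adj v u) × (∀ u → adj u u ≡ false)

NonComplete : ∀ {n} → Adj n → Set
NonComplete {n} adj = Σ (Fin n) λ u → Σ (Fin n) λ v → u ≢ v × adj u v ≡ false

Consec : ∀ {k} → Fin k → Fin k → Set
Consec {k} i j = (toℕ j ≡ suc (toℕ i)) ⊎ (toℕ i ≡ 0 × toℕ j ≡ k ∸ 1)

IsCycle : ∀ {n k} → Adj n → (Fin k → Fin n) → Set
IsCycle {n} {k} adj c =
  (∀ i j → c i ≡ c j → i ≡ j) × (∀ i j → Consec i j → adj (c i) (c j) ≡ true)

HasChord : ∀ {n k} → Adj n → (Fin k → Fin n) → Set
HasChord {n} {k} adj c = Σ (Fin k) λ i → Σ (Fin k) λ j →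
  i ≢ j × ¬ Consec i j × ¬ Consec j i × adj (c i) (c j) ≡ true

Chordal : ∀ {n} → Adj n → Set
Chordal {n} adj = ∀ k → 4 ≤ k → (c : Fin k → Fin n) → IsCycle adj c → HasChord adj c

IsClique : ∀ {n} → Adj n → Subset n → Set
IsClique {n} adj S = ∀ u v → u ∈ S → v ∈ S → u ≢ v → adj u v ≡ true

isClique? : ∀ {n} (adj : Adj n) (S : Subset n) → Dec (IsClique adj S)
isClique? adj S = all? λ u → all? λ v →
  (u ∈? S) →-dec ((v ∈? S) →-dec (¬? (u ≟ v) →-dec (adj u v Bool.≟ true)))

IsMaximalClique : ∀ {n} → Adj n → Subset n → Set
IsMaximalClique {n} adj C =
  IsClique adj C × (∀ C′ → C ⊆ C′ → IsClique adj C′ → C′ ≡ C)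

CliqueNumber : ∀ {n} → Adj n → ℕ → Set
CliqueNumber {n} adj d =
  (Σ (Subset n) λ S → IsClique adj S × ∣ S ∣ ≡ d) ×
  (∀ S → IsClique adj S → ∣ S ∣ ≤ d)

allSubsets : ∀ n → List (Subset n)
allSubsets zero = [] ∷ []
allSubsets (suc n) =
  List.map (inside ∷_) (allSubsets n) List.++ List.map (outside ∷_) (allSubsets n)

cliqueCount : ∀ {n} → Adj n → ℕ → ℕ
cliqueCount {n} adj i =
  length (List.filter (λ S → isClique? adj S Relation.Nullary.×-dec (∣ S ∣ Data.Nat.≟ i))
                      (allSubsets n))
  where open import Relation.Nullary
        import Data.Nat

cliqueVector : ∀ {n} → Adj n → (d : ℕ) → Vec ℕ d
cliqueVector adj d = tabulate λ k → cliqueCount adj (suc (toℕ k))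

evalPoly : ∀ {m} → Vec ℤ m → ℤ → ℤ
evalPoly [] y = + 0
evalPoly (a ∷ as) y = a ℤ.+ y ℤ.* evalPoly as y

-- b is the b-vector of the clique vector (c_1,…,c_d):
--   Σ_i b_i (x+1)^{i-1} = Σ_i c_i x^{i-1}  (as polynomials, i.e. for all x ∈ ℤ)
IsBVector : ∀ {n} → Adj n → (d : ℕ) → Vec ℤ d → Set
IsBVector adj d b =
  ∀ (x : ℤ) → evalPoly b (x ℤ.+ + 1) ≡ evalPoly (Vec.map +_ (cliqueVector adj d)) x

-- Threshold graphs: built from a single vertex by repeatedly adding an
-- isolated vertex or a dominating vertex.  τ lists the vertices in the
-- order they are added (τ ⟨$⟩ʳ 0 is the initial vertex).

IsThreshold : ∀ {n} → Adj n → Set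
IsThreshold {n} adj = Simple adj × 1 ≤ n × Σ (Permutation′ n) λ τ → ∀ k →
  (∀ j → j Fin.< k → adj (τ ⟨$⟩ʳ k) (τ ⟨$⟩ʳ j) ≡ true) ⊎
  (∀ j → j Fin.< k → adj (τ ⟨$⟩ʳ k) (τ ⟨$⟩ʳ j) ≡ false)

-- Orderings.  σ : positions → vertices (0-based positions);
-- pos σ v = σ⁻¹(v).

pos : ∀ {n} → Permutation′ n → Fin n → Fin n
pos σ v = σ ⟨$⟩ˡ v

_≺[_]_ : ∀ {n} → Fin n → Permutation′ n → Fin n → Set
u ≺[ σ ] v = pos σ u Fin.< pos σ v

precedes : ∀ {n} → Permutation′ n → Fin n → Fin n → Bool
precedes σ u v = ⌊ pos σ u Fin.<? pos σ v ⌋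

IsPEO : ∀ {n} → Adj n → Permutation′ n → Set
IsPEO {n} adj σ = ∀ v u w → v ≺[ σ ] u → v ≺[ σ ] w →
  adj v u ≡ true → adj v w ≡ true → u ≢ w → adj u w ≡ true

Nσ : ∀ {n} → Adj n → Permutation′ n → Fin n → Subset n
Nσ adj σ v = tabulate λ u → adj v u ∧ precedes σ v u

nσ : ∀ {n} → Adj n → Permutation′ n → Fin n → ℕ
nσ adj σ v = ∣ Nσ adj σ v ∣

sC : ∀ {n} → Adj n → Permutation′ n → Subset n → Subset n
sC adj σ C = tabulate λ x → ⌊ x ∈? C ⌋ ∧ not ⌊ Nσ adj σ x ⊆? C ⌋

-- The maximum clique K_d = {x_1,…,x_d} is given by x : Fin d → Fin n
-- (x (i-1) is the paper's x_i).

inK : ∀ {n d} → (Fin d → Fin n) → Fin n → Bool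
inK x v = ⌊ any? (λ i → v ≟ x i) ⌋

InK : ∀ {n d} → (Fin d → Fin n) → Fin n → Set
InK x v = inK x v ≡ true

Admissible : ∀ {n d} → Adj n → (Fin d → Fin n) → Permutation′ n → Set
Admissible {n} {d} adj x σ =
  IsPEO adj σ ×
  -- (a)
  ((∀ u v → ¬ InK x u → InK x v → u ≺[ σ ] v) ×
   (∀ (i : Fin d) → toℕ (pos σ (x i)) ≡ n ∸ suc (toℕ i))) ×
  (∀ C → IsMaximalClique adj C →
    -- (b)
    (∀ u v → u ∈ C → u ∉ sC adj σ C → v ∈ sC adj σ C → u ≺[ σ ] v) ×
    -- (c)
    (∀ i → ∣ sC adj σ C ∣ < i → i ≤ ∣ C ∣ →
       ∃! _≡_ (λ u → u ∈ C × u ∉ sC adj σ C × nσ adj σ u ≡ i ∸ 1)) ×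
    -- (d)
    (∀ C′ → IsMaximalClique adj C′ → C′ ≢ C → (∃ λ w → w ∈ C × w ∈ C′) →
       (∀ u w → u ∈ C → u ∉ C′ → w ∈ C → w ∈ C′ → u ≺[ σ ] w) ⊎
       (∀ u w → u ∈ C′ → u ∉ C → w ∈ C → w ∈ C′ → u ≺[ σ ] w)))

-- rank of v in N_σ(u) (0-based): number of w ∈ N_σ(u) preceding v.
-- So v = u_{r+1} in the paper's listing iff rank = r.
rankσ : ∀ {n} → Adj n → Permutation′ n → Fin n → Fin n → ℕ
rankσ adj σ u v = ∣ tabulate (λ w → adj u w ∧ precedes σ u w ∧ precedes σ w v) ∣

eqᵇ : ∀ {n} → Fin n → Fin n → Bool
eqᵇ a b = ⌊ a ≟ b ⌋

-- αMaps u v a b : the (oriented) edge uv of G is sent by α_σ to the edge ab: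
--   uv ⊆ K_d  ↦ uv ;   u ∉ K_d, v = u_{i} ∈ N_σ(u)  ↦ u x_i.
αMaps : ∀ {n d} → Adj n → (Fin d → Fin n) → Permutation′ n →
        Fin n → Fin n → Fin n → Fin n → Bool
αMaps {n} {d} adj x σ u v a b =
  (inK x u ∧ inK x v ∧ eqᵇ a u ∧ eqᵇ b v) ∨
  (not (inK x u) ∧ adj u v ∧ precedes σ u v ∧ eqᵇ a u ∧
     anyL (λ i → (rankσ adj σ u v ≡ᵇ toℕ i) ∧ eqᵇ b (x i)) (allFin d))

αGraph : ∀ {n d} → Adj n → (Fin d → Fin n) → Permutation′ n → Adj n
αGraph {n} adj x σ a b =
  anyL (λ u → anyL (λ v →
     adj u v ∧ (αMaps adj x σ u v a b ∨ αMaps adj x σ u v b a)) (allFin n)) (allFin n)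

cliqueSet : ∀ {n d} → (Fin d → Fin n) → Subset n
cliqueSet x = tabulate (inK x)

-- Counting each clique by its σ-first vertex v, whose other vertices form a subset of the
-- later neighbourhood N_σ(v) (itself a clique, σ being a PEO), gives c_{i+1} = Σ_v C(n_σ(v), i).
-- In T = α_σ(G) a vertex of K_d is joined to the later vertices of K_d, and a vertex v ∉ K_d
-- exactly to x_1, …, x_{n_σ(v)}; so σ is still a PEO of T with the same n_σ, and G and T have
-- the same clique counts, hence the same clique number and b-vector.  Listing the vertices by
-- position with each v ∉ K_d moved just after x_{n_σ(v)+1}, every vertex is joined either to all
-- earlier ones (the x_j) or to none (the v ∉ K_d), so T is threshold.
-- Only the PEO property and condition (a) of admissibility are used; chordality and (b)–(d) are not.

module Submission where

open import Defs
open import Data.Bool.Base using (Bool; true; false; _∧_; _∨_; not; if_then_else_)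
open import Data.Bool.Properties
  using (T-≡; ∧-conicalˡ; ∧-conicalʳ; ∧-zeroʳ; ∧-identityˡ; ∧-identityʳ; ∧-assoc; ¬-not; ⇔→≡)
open import Data.Empty using (⊥; ⊥-elim)
open import Data.Fin.Base as Fin using (Fin; zero; suc; toℕ)
open import Data.Fin.Permutation using (Permutation′; _⟨$⟩ʳ_; permutation; inverseʳ)
import Data.Fin.Properties as Finₚ
open import Data.Integer.Base using (ℤ; +_)
open import Data.Nat.Base using (ℕ; zero; suc; _+_; _*_; _∸_; _≤_; _<_; z≤n; s≤s; _≡ᵇ_)
open import Data.Nat.Properties
open import Data.Product using (∃; _×_; _,_; proj₁; proj₂)
open import Data.Sum as Sum using (_⊎_; inj₁; inj₂)
open import Data.Vec.Base as Vec using (Vec; []; _∷_; lookup; tabulate; _[_]≔_)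
open import Data.Fin.Subset using (Subset; inside; outside; ∣_∣; _∈_; _⊆_) renaming (⊥ to ∅)
open import Data.Fin.Subset.Properties using (_⊆?_; ∉⊥; ∣⊥∣≡0)
open import Data.Vec.Properties using (tabulate-cong; lookup∘tabulate; []=⇒lookup; lookup⇒[]=; lookup∘update; lookup∘update′)
open import Data.List.Base as List using (length; filter; allFin)
open import Data.Bool.ListAction renaming (any to anyL)
open import Data.List.Properties using (length-++; filter-++)
open import Data.Nat.Combinatorics using (_C_; nCk+nC[k+1]≡[n+1]C[k+1])
open import Function.Base using (id; _∘_; const; case_of_)
open import Function.Bundles using (_⇔_; mk⇔; Equivalence)
open import Relation.Nullary using (Dec; yes; no; ¬_; _×-dec_)
open import Relation.Nullary.Decidable using (⌊_⌋; isYes≗does; dec-true; dec-false; does-⇔; ⌊⌋-map′)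
open import Relation.Binary.PropositionalEquality
open import Relation.Binary.Definitions using (tri<; tri≈; tri>)

open import Algebra.Properties.CommutativeMonoid.Sum +-0-commutativeMonoid
  using (sum-syntax; ∑-comm; ∑-distrib-+; sum-cong-≗; sum-replicate-zero)

∧-intro : ∀ {a b} → a ≡ true → b ≡ true → a ∧ b ≡ true
∧-intro refl refl = refl

∧-elim : ∀ a {b} → a ∧ b ≡ true → a ≡ true × b ≡ true
∧-elim true b≡true = refl , b≡true

∨-introˡ : ∀ {a} b → a ≡ true → a ∨ b ≡ true
∨-introˡ _ refl = refl

∨-introʳ : ∀ a {b} → b ≡ true → a ∨ b ≡ true
∨-introʳ true _ = refl
∨-introʳ false b≡true = b≡true

∨-elim : ∀ a {b} → a ∨ b ≡ true → a ≡ true ⊎ b ≡ true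
∨-elim true _ = inj₁ refl
∨-elim false b≡true = inj₂ b≡true

by-cases : ∀ {a} {A : Set a} b → (b ≡ true → A) → (b ≡ false → A) → A
by-cases true t _ = t refl
by-cases false _ f = f refl

absurdᵇ : ∀ {a} {A : Set a} {b} → b ≡ true → b ≡ false → A
absurdᵇ refl ()

⌊⌋-true : ∀ {p} {P : Set p} (P? : Dec P) → P → ⌊ P? ⌋ ≡ true
⌊⌋-true P? p = trans (isYes≗does P?) (dec-true P? p)

⌊⌋-false : ∀ {p} {P : Set p} (P? : Dec P) → ¬ P → ⌊ P? ⌋ ≡ false
⌊⌋-false P? ¬p = trans (isYes≗does P?) (dec-false P? ¬p)

⌊⌋-⇔ : ∀ {p q} {P : Set p} {Q : Set q} → (P → Q) → (Q → P) → (P? : Dec P) (Q? : Dec Q) → ⌊ P? ⌋ ≡ ⌊ Q? ⌋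
⌊⌋-⇔ to from P? Q? = trans (isYes≗does P?) (trans (does-⇔ (mk⇔ to from) P? Q?) (sym (isYes≗does Q?)))

⌊⌋⇒ : ∀ {p} {P : Set p} (P? : Dec P) → ⌊ P? ⌋ ≡ true → P
⌊⌋⇒ (yes p) _ = p
⌊⌋⇒ (no _) ()

⌊×-dec⌋ : ∀ {p q} {P : Set p} {Q : Set q} (P? : Dec P) (Q? : Dec Q) → ⌊ P? ×-dec Q? ⌋ ≡ ⌊ P? ⌋ ∧ ⌊ Q? ⌋
⌊×-dec⌋ P? Q? = trans (isYes≗does (P? ×-dec Q?)) (sym (cong₂ _∧_ (isYes≗does P?) (isYes≗does Q?)))

⌊suc≟suc⌋ : ∀ a b → ⌊ suc a ≟ suc b ⌋ ≡ ⌊ a ≟ b ⌋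
⌊suc≟suc⌋ a b with a ≟ b
... | yes a≡b = ⌊⌋-true (suc a ≟ suc b) (cong suc a≡b)
... | no a≢b = ⌊⌋-false (suc a ≟ suc b) (a≢b ∘ suc-injective)

≡ᵇ-true⇒≡ : ∀ m k → (m ≡ᵇ k) ≡ true → m ≡ k
≡ᵇ-true⇒≡ m k p = ≡ᵇ⇒≡ m k (Equivalence.from T-≡ p)

≡⇒≡ᵇ-true : ∀ m k → m ≡ k → (m ≡ᵇ k) ≡ true
≡⇒≡ᵇ-true m k p = Equivalence.to T-≡ (≡⇒≡ᵇ m k p)

any-tabulate⁺ : ∀ {a} {A : Set a} {m} (f : A → Bool) (g : Fin m → A) i →
                f (g i) ≡ true → anyL f (List.tabulate g) ≡ true
any-tabulate⁺ f g zero fgi = ∨-introˡ (anyL f (List.tabulate (g ∘ suc))) fgi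
any-tabulate⁺ f g (suc i) fgi = ∨-introʳ (f (g zero)) (any-tabulate⁺ f (g ∘ suc) i fgi)

any-tabulate⁻ : ∀ {a} {A : Set a} {m} (f : A → Bool) (g : Fin m → A) →
                anyL f (List.tabulate g) ≡ true → ∃ λ i → f (g i) ≡ true
any-tabulate⁻ {m = suc m} f g any with ∨-elim (f (g zero)) any
... | inj₁ fg0 = zero , fg0
... | inj₂ any′ with i , fgi ← any-tabulate⁻ f (g ∘ suc) any′ = suc i , fgi

𝟙[_] : Bool → ℕ
𝟙[ true ] = 1
𝟙[ false ] = 0

-- Counting

count : ∀ {n} → (Fin n → Bool) → ℕ
count {n} f = ∑[ i < n ] 𝟙[ f i ]

count-cong : ∀ {n} {f g : Fin n → Bool} → (∀ i → f i ≡ g i) → count f ≡ count g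
count-cong f≗g = sum-cong-≗ (cong 𝟙[_] ∘ f≗g)

count-false : ∀ {n} → count {n} (const false) ≡ 0
count-false {n} = sum-replicate-zero n

count-true : ∀ {n} → count {n} (const true) ≡ n
count-true {zero} = refl
count-true {suc n} = cong suc (count-true {n})

𝟙-mono : ∀ {a b} → (a ≡ true → b ≡ true) → 𝟙[ a ] ≤ 𝟙[ b ]
𝟙-mono {false} _ = z≤n
𝟙-mono {true} a⇒b rewrite a⇒b refl = ≤-refl

count-mono : ∀ {n} {f g : Fin n → Bool} → (∀ i → f i ≡ true → g i ≡ true) → count f ≤ count g
count-mono {zero} _ = z≤n
count-mono {suc n} f⇒g = +-mono-≤ (𝟙-mono (f⇒g zero)) (count-mono (f⇒g ∘ suc))

count-mono-< : ∀ {n} {f g : Fin n → Bool} → (∀ i → f i ≡ true → g i ≡ true) →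
               ∀ k → f k ≡ false → g k ≡ true → count f < count g
count-mono-< {suc n} {f} {g} f⇒g zero fk gk rewrite fk | gk = s≤s (count-mono (f⇒g ∘ suc))
count-mono-< {suc n} f⇒g (suc k) fk gk =
  +-mono-≤-< (𝟙-mono (f⇒g zero)) (count-mono-< (f⇒g ∘ suc) k fk gk)

count-pos : ∀ {n} {f : Fin n → Bool} → 0 < count f → ∃ λ i → f i ≡ true
count-pos {suc n} {f} 0<c with f zero in eq
... | true = zero , eq
... | false with i , fi ← count-pos {f = f ∘ suc} 0<c = suc i , fi

count-pos⁺ : ∀ {n} {f : Fin n → Bool} i → f i ≡ true → 0 < count f
count-pos⁺ {n} {f} i fi = subst (_< count f) (count-false {n}) (count-mono-< (λ _ ()) i refl fi)

count≡0⇒false : ∀ {n} {f : Fin n → Bool} → count f ≡ 0 → ∀ i → f i ≡ false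
count≡0⇒false c≡0 i = ¬-not λ fi → <⇒≢ (count-pos⁺ i fi) (sym c≡0)

AtMostOne : ∀ {n} → (Fin n → Bool) → Set
AtMostOne f = ∀ i j → f i ≡ true → f j ≡ true → i ≡ j

count≤1 : ∀ {n} {f : Fin n → Bool} → AtMostOne f → count f ≤ 1
count≤1 {zero} _ = z≤n
count≤1 {suc n} {f} uniq with f zero in eq
... | true = s≤s (≤-reflexive (trans (count-cong tail-false) (count-false {n})))
  where
  tail-false : ∀ i → f (suc i) ≡ false
  tail-false i = ¬-not λ fi → Finₚ.0≢1+n (uniq zero (suc i) eq fi)
... | false = count≤1 λ i j p q → Finₚ.suc-injective (uniq (suc i) (suc j) p q)

count≡𝟙 : ∀ {n} {f : Fin n → Bool} {b} → AtMostOne f →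
          (b ≡ true → ∃ λ i → f i ≡ true) → (∀ i → f i ≡ true → b ≡ true) → count f ≡ 𝟙[ b ]
count≡𝟙 {b = true} uniq witness _ with i , fi ← witness refl =
  ≤-antisym (count≤1 uniq) (count-pos⁺ i fi)
count≡𝟙 {n} {b = false} _ _ sound =
  trans (count-cong λ i → ¬-not λ fi → case sound i fi of λ ()) (count-false {n})

eqᵇ⇒≡ : ∀ {n} (a b : Fin n) → eqᵇ a b ≡ true → a ≡ b
eqᵇ⇒≡ a b = ⌊⌋⇒ (a Finₚ.≟ b)

eqᵇ-refl : ∀ {n} (a : Fin n) → eqᵇ a a ≡ true
eqᵇ-refl a = ⌊⌋-true (a Finₚ.≟ a) refl

count-eqᵇ : ∀ {n} (c : Fin n) β → count (λ w → eqᵇ w c ∧ β) ≡ 𝟙[ β ]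
count-eqᵇ c β = count≡𝟙
  (λ a b p q → trans (eqᵇ⇒≡ a c (∧-conicalˡ (eqᵇ a c) β p)) (sym (eqᵇ⇒≡ b c (∧-conicalˡ (eqᵇ b c) β q))))
  (λ β≡true → c , ∧-intro (eqᵇ-refl c) β≡true)
  (λ w → ∧-conicalʳ (eqᵇ w c) β)

∣∣≡count : ∀ {n} (S : Subset n) → ∣ S ∣ ≡ count (lookup S)
∣∣≡count [] = refl
∣∣≡count (true ∷ S) = cong suc (∣∣≡count S)
∣∣≡count (false ∷ S) = ∣∣≡count S

∣tabulate∣≡count : ∀ {n} (f : Fin n → Bool) → ∣ tabulate f ∣ ≡ count f
∣tabulate∣≡count f = trans (∣∣≡count (tabulate f)) (count-cong (lookup∘tabulate f))

count-< : ∀ {d} k → k ≤ d → count {d} (λ i → ⌊ toℕ i <? k ⌋) ≡ k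
count-< {zero} zero _ = refl
count-< {suc d} zero _ = trans (count-cong {suc d} λ i → ⌊⌋-false (toℕ i <? 0) λ ()) (count-false {suc d})
count-< {suc d} (suc k) (s≤s k≤d) = cong suc (trans
  (count-cong {d} λ i → ⌊⌋-⇔ ≤-pred s≤s (suc (toℕ i) <? suc k) (toℕ i <? k))
  (count-< k k≤d))

≤-sum : ∀ {n} (f : Fin n → ℕ) i → f i ≤ ∑[ j < n ] f j
≤-sum f zero = m≤m+n _ _
≤-sum f (suc i) = ≤-trans (≤-sum (f ∘ suc) i) (m≤n+m _ _)

∈-tabulate⁻ : ∀ {n} {f : Fin n → Bool} {w} → w ∈ tabulate f → f w ≡ true
∈-tabulate⁻ {f = f} {w} w∈ = trans (sym (lookup∘tabulate f w)) ([]=⇒lookup w∈)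

∈-tabulate⁺ : ∀ {n} {f : Fin n → Bool} {w} → f w ≡ true → w ∈ tabulate f
∈-tabulate⁺ {f = f} {w} fw = lookup⇒[]= w _ (trans (lookup∘tabulate f w) fw)

-- Order statistics and sorting

squeeze : ∀ {r a b} → a ≤ r → r < a + b → b ≤ 1 → a ≡ r × 0 < b
squeeze {r} {a} {zero} a≤r r<a+0 _ = ⊥-elim (<⇒≱ r<a+0 (subst (_≤ r) (sym (+-identityʳ a)) a≤r))
squeeze {r} {a} {suc zero} a≤r r<a+1 _ =
  ≤-antisym a≤r (≤-pred (subst (r <_) (+-comm a 1) r<a+1)) , s≤s z≤n
squeeze {b = suc (suc _)} _ _ (s≤s ())

𝟙-split : ∀ {a b c x y z} → a ≡ x → b ≡ y → c ≡ z →
          𝟙[ x ] ≡ 𝟙[ y ] + 𝟙[ z ] → 𝟙[ a ] ≡ 𝟙[ b ] + 𝟙[ c ]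
𝟙-split refl refl refl e = e

𝟙-<-suc : ∀ b m t → 𝟙[ b ∧ ⌊ m <? suc t ⌋ ] ≡ 𝟙[ b ∧ ⌊ m <? t ⌋ ] + 𝟙[ b ∧ ⌊ m ≟ t ⌋ ]
𝟙-<-suc false m t = refl
𝟙-<-suc true m t with <-cmp m t
... | tri< m<t m≢t _ =
  𝟙-split (⌊⌋-true (m <? suc t) (m<n⇒m<1+n m<t)) (⌊⌋-true (m <? t) m<t) (⌊⌋-false (m ≟ t) m≢t) refl
... | tri≈ m≮t m≡t _ =
  𝟙-split (⌊⌋-true (m <? suc t) (s≤s (≤-reflexive m≡t))) (⌊⌋-false (m <? t) m≮t) (⌊⌋-true (m ≟ t) m≡t) refl
... | tri> m≮t m≢t _ =
  𝟙-split (⌊⌋-false (m <? suc t) (λ m<1+t → m≮t (≤∧≢⇒< (≤-pred m<1+t) m≢t)))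
          (⌊⌋-false (m <? t) m≮t) (⌊⌋-false (m ≟ t) m≢t) refl

module OrderStatistic {n} (g : Fin n → ℕ) (g-injective : ∀ a b → g a ≡ g b → a ≡ b) where

  module _ (P : Fin n → Bool) where

    private
      #below : ℕ → ℕ
      #below t = count λ w → P w ∧ ⌊ g w <? t ⌋

      #at : ℕ → ℕ
      #at t = count λ w → P w ∧ ⌊ g w ≟ t ⌋

      #below-suc : ∀ t → #below (suc t) ≡ #below t + #at t
      #below-suc t = trans (sum-cong-≗ λ w → 𝟙-<-suc (P w) (g w) t)
                           (∑-distrib-+ (λ w → 𝟙[ P w ∧ ⌊ g w <? t ⌋ ]) (λ w → 𝟙[ P w ∧ ⌊ g w ≟ t ⌋ ]))

      #below-0 : #below 0 ≡ 0
      #below-0 = trans (count-cong λ w → ∧-zeroʳ (P w)) (count-false {n})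

      #below-all : #below (suc (∑[ i < n ] g i)) ≡ count P
      #below-all = count-cong λ w →
        trans (cong (P w ∧_) (⌊⌋-true (g w <? suc (∑[ i < n ] g i)) (s≤s (≤-sum g w)))) (∧-identityʳ (P w))

      #at≤1 : ∀ t → #at t ≤ 1
      #at≤1 t = count≤1 λ i j p q →
        g-injective i j (trans (⌊⌋⇒ (g i ≟ t) (∧-conicalʳ _ _ p)) (sym (⌊⌋⇒ (g j ≟ t) (∧-conicalʳ _ _ q))))

      crossing : ∀ r M → r < #below M → ∃ λ t → #below t ≤ r × r < #below (suc t)
      crossing r zero r<0 = ⊥-elim (<⇒≱ r<0 (subst (_≤ r) (sym #below-0) z≤n))
      crossing r (suc M) r< with r <? #below M
      ... | yes r<M = crossing r M r<M
      ... | no r≮M = M , ≮⇒≥ r≮M , r<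

    -- Since g is injective, #below t grows by at most one at each step, so it hits every r < count P.
    order-statistic : ∀ r → r < count P → ∃ λ v → P v ≡ true × count (λ w → P w ∧ ⌊ g w <? g v ⌋) ≡ r
    order-statistic r r<#P
      with t , #t≤r , r<#t+1 ← crossing r _ (subst (r <_) (sym #below-all) r<#P)
      with #t≡r , 0<#at ← squeeze #t≤r (subst (r <_) (#below-suc t) r<#t+1) (#at≤1 t)
      with v , pv ← count-pos 0<#at
      = v , ∧-conicalˡ _ _ pv , trans (cong #below (⌊⌋⇒ (g v ≟ t) (∧-conicalʳ _ _ pv))) #t≡r

  rank : Fin n → ℕ
  rank v = count λ w → ⌊ g w <? g v ⌋

  rank-mono-< : ∀ a b → g a < g b → rank a < rank b
  rank-mono-< a b ga<gb = count-mono-<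
    (λ w gw<ga → ⌊⌋-true (g w <? g b) (<-trans (⌊⌋⇒ (g w <? g a) gw<ga) ga<gb)) a
    (⌊⌋-false (g a <? g a) (<-irrefl refl)) (⌊⌋-true (g a <? g b) ga<gb)

  rank-injective : ∀ a b → rank a ≡ rank b → a ≡ b
  rank-injective a b ra≡rb with <-cmp (g a) (g b)
  ... | tri< ga<gb _ _ = ⊥-elim (<⇒≢ (rank-mono-< a b ga<gb) ra≡rb)
  ... | tri≈ _ ga≡gb _ = g-injective a b ga≡gb
  ... | tri> _ _ gb<ga = ⊥-elim (<⇒≢ (rank-mono-< b a gb<ga) (sym ra≡rb))

  rank<n : ∀ v → rank v < n
  rank<n v = subst (rank v <_) (count-true {n})
    (count-mono-< (λ _ _ → refl) v (⌊⌋-false (g v <? g v) (<-irrefl refl)) refl)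

  private
    toℕ<#true : ∀ (k : Fin n) → toℕ k < count {n} (const true)
    toℕ<#true k = subst (toℕ k <_) (sym (count-true {n})) (Finₚ.toℕ<n k)

    unrank : Fin n → Fin n
    unrank k = proj₁ (order-statistic (const true) (toℕ k) (toℕ<#true k))

    rank∘unrank : ∀ k → rank (unrank k) ≡ toℕ k
    rank∘unrank k = proj₂ (proj₂ (order-statistic (const true) (toℕ k) (toℕ<#true k)))

    rankFin : Fin n → Fin n
    rankFin v = Fin.fromℕ< (rank<n v)

    unrank∘rankFin : ∀ v → unrank (rankFin v) ≡ v
    unrank∘rankFin v = rank-injective (unrank (rankFin v)) v
      (trans (rank∘unrank (rankFin v)) (Finₚ.toℕ-fromℕ< (rank<n v)))

    rankFin∘unrank : ∀ k → rankFin (unrank k) ≡ k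
    rankFin∘unrank k = Finₚ.toℕ-injective (trans (Finₚ.toℕ-fromℕ< (rank<n (unrank k))) (rank∘unrank k))

  sortBy : Permutation′ n
  sortBy = permutation unrank rankFin unrank∘rankFin rankFin∘unrank

  sortBy-increasing : ∀ j k → j Fin.< k → g (sortBy ⟨$⟩ʳ j) < g (sortBy ⟨$⟩ʳ k)
  sortBy-increasing j k j<k = ≰⇒> λ gk≤gj → case m≤n⇒m<n∨m≡n gk≤gj of λ where
    (inj₁ gk<gj) → <⇒≯ j<k
      (subst₂ _<_ (rank∘unrank k) (rank∘unrank j) (rank-mono-< (unrank k) (unrank j) gk<gj))
    (inj₂ gk≡gj) → <⇒≢ j<k (trans (sym (rank∘unrank j))
      (trans (cong rank (g-injective (unrank j) (unrank k) (sym gk≡gj))) (rank∘unrank k)))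

-- Threshold graphs

threshold-by-key : ∀ {n} (G : Adj n) → Simple G → 1 ≤ n → (key : Fin n → ℕ) →
  (∀ a → (∀ b → b ≢ a → key b ≤ key a → G a b ≡ true) ⊎ (∀ b → key b ≤ key a → G a b ≡ false)) →
  IsThreshold G
threshold-by-key {n} G simple 1≤n key dominating-or-isolated = simple , 1≤n , sortBy , step
  where
  g : Fin n → ℕ
  g v = key v * n + toℕ v

  g<next : ∀ v → g v < suc (key v) * n
  g<next v = subst (g v <_) (+-comm (key v * n) n) (+-monoʳ-< (key v * n) (Finₚ.toℕ<n v))

  key<⇒g< : ∀ a b → key a < key b → g a < g b
  key<⇒g< a b ka<kb = <-≤-trans (g<next a) (≤-trans (*-mono-≤ ka<kb (≤-refl {n})) (m≤m+n (key b * n) (toℕ b)))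

  g-injective : ∀ a b → g a ≡ g b → a ≡ b
  g-injective a b ga≡gb with <-cmp (key a) (key b)
  ... | tri< ka<kb _ _ = ⊥-elim (<⇒≢ (key<⇒g< a b ka<kb) ga≡gb)
  ... | tri> _ _ kb<ka = ⊥-elim (<⇒≢ (key<⇒g< b a kb<ka) (sym ga≡gb))
  ... | tri≈ _ ka≡kb _ = Finₚ.toℕ-injective
        (+-cancelˡ-≡ (key a * n) (toℕ a) (toℕ b) (trans ga≡gb (cong (λ k → k * n + toℕ b) (sym ka≡kb))))

  g<⇒key≤ : ∀ {a b} → g b < g a → key b ≤ key a
  g<⇒key≤ {a} {b} gb<ga = ≮⇒≥ λ ka<kb → <-asym gb<ga (key<⇒g< a b ka<kb)

  open OrderStatistic g g-injective using (sortBy; sortBy-increasing)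

  τ : Fin n → Fin n
  τ = sortBy ⟨$⟩ʳ_

  step : ∀ k → (∀ j → j Fin.< k → G (τ k) (τ j) ≡ true) ⊎ (∀ j → j Fin.< k → G (τ k) (τ j) ≡ false)
  step k = Sum.map
    (λ dominating j j<k → dominating (τ j) (λ eq → <-irrefl (cong g eq) (sortBy-increasing j k j<k))
                                           (g<⇒key≤ (sortBy-increasing j k j<k)))
    (λ isolated j j<k → isolated (τ j) (g<⇒key≤ (sortBy-increasing j k j<k)))
    (dominating-or-isolated (τ k))

-- Sums over all subsets

∑ˢ : ∀ n → (Subset n → ℕ) → ℕ
∑ˢ zero f = f []
∑ˢ (suc n) f = ∑ˢ n (f ∘ (inside ∷_)) + ∑ˢ n (f ∘ (outside ∷_))

∑ˢ-cong : ∀ n {f g : Subset n → ℕ} → (∀ S → f S ≡ g S) → ∑ˢ n f ≡ ∑ˢ n g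
∑ˢ-cong zero f≗g = f≗g []
∑ˢ-cong (suc n) f≗g = cong₂ _+_ (∑ˢ-cong n (f≗g ∘ (inside ∷_))) (∑ˢ-cong n (f≗g ∘ (outside ∷_)))

∑ˢ-zero : ∀ n → ∑ˢ n (const 0) ≡ 0
∑ˢ-zero zero = refl
∑ˢ-zero (suc n) = cong₂ _+_ (∑ˢ-zero n) (∑ˢ-zero n)

∑ˢ-comm : ∀ n {m} (f : Fin m → Subset n → ℕ) →
          ∑ˢ n (λ S → ∑[ v < m ] f v S) ≡ ∑[ v < m ] ∑ˢ n (f v)
∑ˢ-comm zero f = refl
∑ˢ-comm (suc n) f = trans
  (cong₂ _+_ (∑ˢ-comm n (λ v → f v ∘ (inside ∷_))) (∑ˢ-comm n (λ v → f v ∘ (outside ∷_))))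
  (sym (∑-distrib-+ (λ v → ∑ˢ n (f v ∘ (inside ∷_))) (λ v → ∑ˢ n (f v ∘ (outside ∷_)))))

≤-∑ˢ : ∀ n (f : Subset n → ℕ) S → f S ≤ ∑ˢ n f
≤-∑ˢ zero f [] = ≤-refl
≤-∑ˢ (suc n) f (true ∷ S) = ≤-trans (≤-∑ˢ n (f ∘ (inside ∷_)) S) (m≤m+n _ _)
≤-∑ˢ (suc n) f (false ∷ S) = ≤-trans (≤-∑ˢ n (f ∘ (outside ∷_)) S) (m≤n+m _ _)

∑ˢ-pos : ∀ n (f : Subset n → ℕ) → 0 < ∑ˢ n f → ∃ λ S → 0 < f S
∑ˢ-pos zero f 0<f = [] , 0<f
∑ˢ-pos (suc n) f 0<∑ with ∑ˢ n (f ∘ (inside ∷_)) in eq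
... | suc _ with S , 0<fS ← ∑ˢ-pos n (f ∘ (inside ∷_)) (subst (0 <_) (sym eq) (s≤s z≤n)) =
  inside ∷ S , 0<fS
... | zero with S , 0<fS ← ∑ˢ-pos n (f ∘ (outside ∷_)) 0<∑ = outside ∷ S , 0<fS

length-filter-map : ∀ {a b p} {A : Set a} {B : Set b} {P : B → Set p} (P? : ∀ y → Dec (P y))
                    (f : A → B) xs →
                    length (filter P? (List.map f xs)) ≡ length (filter (P? ∘ f) xs)
length-filter-map P? f List.[] = refl
length-filter-map P? f (x List.∷ xs) with P? (f x)
... | yes _ = cong suc (length-filter-map P? f xs)
... | no _ = length-filter-map P? f xs

length-filter-allSubsets : ∀ n {p} {P : Subset n → Set p} (P? : ∀ S → Dec (P S)) →
                           length (filter P? (allSubsets n)) ≡ ∑ˢ n (λ S → 𝟙[ ⌊ P? S ⌋ ])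
length-filter-allSubsets zero P? with P? []
... | yes _ = refl
... | no _ = refl
length-filter-allSubsets (suc n) P? = begin
  length (filter P? (List.map (inside ∷_) L List.++ List.map (outside ∷_) L))
    ≡⟨ cong length (filter-++ P? (List.map (inside ∷_) L) _) ⟩
  length (filter P? (List.map (inside ∷_) L) List.++ filter P? (List.map (outside ∷_) L))
    ≡⟨ length-++ (filter P? (List.map (inside ∷_) L)) ⟩
  length (filter P? (List.map (inside ∷_) L)) + length (filter P? (List.map (outside ∷_) L))
    ≡⟨ cong₂ _+_ (trans (length-filter-map P? _ L) (length-filter-allSubsets n (P? ∘ (inside ∷_))))
                 (trans (length-filter-map P? _ L) (length-filter-allSubsets n (P? ∘ (outside ∷_)))) ⟩
  ∑ˢ (suc n) (λ S → 𝟙[ ⌊ P? S ⌋ ]) ∎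
  where
  open ≡-Reasoning
  L = allSubsets n

∑ˢ-insert : ∀ n (v : Fin n) (F : Subset n → ℕ) →
            ∑ˢ n (λ S → if lookup S v then F S else 0) ≡
            ∑ˢ n (λ R → if lookup R v then 0 else F (R [ v ]≔ inside))
∑ˢ-insert (suc n) zero F = +-comm (∑ˢ n (F ∘ (inside ∷_))) (∑ˢ n (const 0))
∑ˢ-insert (suc n) (suc v) F =
  cong₂ _+_ (∑ˢ-insert n v (F ∘ (inside ∷_))) (∑ˢ-insert n v (F ∘ (outside ∷_)))

∣[]≔inside∣ : ∀ {n} (R : Subset n) v → lookup R v ≡ false → ∣ R [ v ]≔ inside ∣ ≡ suc ∣ R ∣
∣[]≔inside∣ (b ∷ R) zero refl = refl
∣[]≔inside∣ (true ∷ R) (suc v) v∉R = cong suc (∣[]≔inside∣ R v v∉R)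
∣[]≔inside∣ (false ∷ R) (suc v) v∉R = ∣[]≔inside∣ R v v∉R

∑ˢ-⊆-size : ∀ n (N : Subset n) i → ∑ˢ n (λ R → 𝟙[ ⌊ R ⊆? N ⌋ ∧ ⌊ ∣ R ∣ ≟ i ⌋ ]) ≡ ∣ N ∣ C i
∑ˢ-⊆-size zero [] zero = refl
∑ˢ-⊆-size zero [] (suc i) = refl
∑ˢ-⊆-size (suc n) (outside ∷ N) i =
  trans (cong₂ _+_ (∑ˢ-zero n) (∑ˢ-cong n λ R → cong (λ b → 𝟙[ b ∧ _ ]) (⌊⌋-map′ _ _ (R ⊆? N))))
        (∑ˢ-⊆-size n N i)
∑ˢ-⊆-size (suc n) (inside ∷ N) i = begin
  ∑ˢ n (λ R → 𝟙[ ⌊ inside ∷ R ⊆? inside ∷ N ⌋ ∧ ⌊ suc ∣ R ∣ ≟ i ⌋ ]) +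
  ∑ˢ n (λ R → 𝟙[ ⌊ outside ∷ R ⊆? inside ∷ N ⌋ ∧ ⌊ ∣ R ∣ ≟ i ⌋ ])
    ≡⟨ cong₂ _+_ (∑ˢ-cong n λ R → cong (λ b → 𝟙[ b ∧ _ ]) (⌊⌋-map′ _ _ (R ⊆? N)))
                 (trans (∑ˢ-cong n λ R → cong (λ b → 𝟙[ b ∧ _ ]) (⌊⌋-map′ _ _ (R ⊆? N))) (∑ˢ-⊆-size n N i)) ⟩
  ∑ˢ n (λ R → 𝟙[ ⌊ R ⊆? N ⌋ ∧ ⌊ suc ∣ R ∣ ≟ i ⌋ ]) + ∣ N ∣ C i
    ≡⟨ pascal i ⟩
  suc ∣ N ∣ C i ∎
  where
  open ≡-Reasoning
  pascal : ∀ i → ∑ˢ n (λ R → 𝟙[ ⌊ R ⊆? N ⌋ ∧ ⌊ suc ∣ R ∣ ≟ i ⌋ ]) + ∣ N ∣ C i ≡ suc ∣ N ∣ C i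
  pascal zero = cong (_+ ∣ N ∣ C 0) (trans (∑ˢ-cong n λ R → cong 𝟙[_] (∧-zeroʳ ⌊ R ⊆? N ⌋)) (∑ˢ-zero n))
  pascal (suc i) = trans
    (cong (_+ ∣ N ∣ C suc i) (trans (∑ˢ-cong n λ R → cong (λ b → 𝟙[ ⌊ R ⊆? N ⌋ ∧ b ]) (⌊suc≟suc⌋ ∣ R ∣ i))
                                   (∑ˢ-⊆-size n N i)))
    (nCk+nC[k+1]≡[n+1]C[k+1] ∣ N ∣ i)

-- Cliques along a perfect elimination ordering

module _ {n} (σ : Permutation′ n) where

  pos-injective : ∀ {u v} → pos σ u ≡ pos σ v → u ≡ v
  pos-injective eq = trans (sym (inverseʳ σ)) (trans (cong (σ ⟨$⟩ʳ_) eq) (inverseʳ σ))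

  posℕ : Fin n → ℕ
  posℕ = toℕ ∘ pos σ

  posℕ-injective : ∀ u v → posℕ u ≡ posℕ v → u ≡ v
  posℕ-injective u v eq = pos-injective (Finₚ.toℕ-injective eq)

  precedes-irrefl : ∀ u → precedes σ u u ≡ false
  precedes-irrefl u = ⌊⌋-false (pos σ u Finₚ.<? pos σ u) (<-irrefl refl)

  precedes-asym : ∀ {u v} → u ≺[ σ ] v → precedes σ v u ≡ false
  precedes-asym {u} {v} u≺v = ⌊⌋-false (pos σ v Finₚ.<? pos σ u) (<-asym u≺v)

  precedes-connex : ∀ {u v} → u ≢ v → precedes σ u v ≡ false → v ≺[ σ ] u
  precedes-connex {u} {v} u≢v u⊀v = ≤∧≢⇒<
    (≮⇒≥ λ u≺v → absurdᵇ (⌊⌋-true (pos σ u Finₚ.<? pos σ v) u≺v) u⊀v)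
    (λ eq → u≢v (pos-injective (Finₚ.toℕ-injective (sym eq))))

module _ {n} (A : Adj n) (σ : Permutation′ n) {v w : Fin n} where

  private
    v<?w = pos σ v Finₚ.<? pos σ w

  ∈Nσ⁻ : w ∈ Nσ A σ v → A v w ≡ true × v ≺[ σ ] w
  ∈Nσ⁻ w∈ = ∧-conicalˡ _ _ (∈-tabulate⁻ w∈) , ⌊⌋⇒ v<?w (∧-conicalʳ _ _ (∈-tabulate⁻ w∈))

  ∈Nσ⁺ : A v w ≡ true → v ≺[ σ ] w → w ∈ Nσ A σ v
  ∈Nσ⁺ avw v≺w = ∈-tabulate⁺ (∧-intro avw (⌊⌋-true v<?w v≺w))

isCliqueOfSize : ∀ {n} → Adj n → Subset n → ℕ → Bool
isCliqueOfSize A S m = ⌊ isClique? A S ⌋ ∧ ⌊ ∣ S ∣ ≟ m ⌋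

cliqueCount≡∑ˢ : ∀ {n} (A : Adj n) m → cliqueCount A m ≡ ∑ˢ n (λ S → 𝟙[ isCliqueOfSize A S m ])
cliqueCount≡∑ˢ {n} A m = trans (length-filter-allSubsets n (λ S → isClique? A S ×-dec (∣ S ∣ ≟ m)))
  (∑ˢ-cong n λ S → cong 𝟙[_] (⌊×-dec⌋ (isClique? A S) (∣ S ∣ ≟ m)))

module PEOCliques {n} (A : Adj n) (σ : Permutation′ n) (simple : Simple A) (peo : IsPEO A σ) where

  open OrderStatistic (posℕ σ) (posℕ-injective σ) using (order-statistic)

  isFirst : Subset n → Fin n → Bool
  isFirst S v = lookup S v ∧ ⌊ count (λ w → lookup S w ∧ precedes σ w v) ≟ 0 ⌋

  private
    nothing-before : ∀ S v → isFirst S v ≡ true → ∀ w → (lookup S w ∧ precedes σ w v) ≡ false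
    nothing-before S v first = count≡0⇒false (⌊⌋⇒ (count (λ w → lookup S w ∧ precedes σ w v) ≟ 0)
                                                     (∧-conicalʳ _ _ first))

  first-unique : ∀ S → AtMostOne (isFirst S)
  first-unique S a b a-first b-first = ≮∧≯⇒≡ a⊀b b⊀a
    where
    a⊀b : ¬ a ≺[ σ ] b
    a⊀b a≺b = absurdᵇ (∧-intro (∧-conicalˡ (lookup S a) _ a-first) (⌊⌋-true (pos σ a Finₚ.<? pos σ b) a≺b))
                      (nothing-before S b b-first a)
    b⊀a : ¬ b ≺[ σ ] a
    b⊀a b≺a = absurdᵇ (∧-intro (∧-conicalˡ (lookup S b) _ b-first) (⌊⌋-true (pos σ b Finₚ.<? pos σ a) b≺a))
                      (nothing-before S a a-first b)
    ≮∧≯⇒≡ : ¬ a ≺[ σ ] b → ¬ b ≺[ σ ] a → a ≡ b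
    ≮∧≯⇒≡ a⊀b b⊀a = pos-injective σ (Finₚ.toℕ-injective (≤-antisym (≮⇒≥ b⊀a) (≮⇒≥ a⊀b)))

  first-exists : ∀ S → 0 < ∣ S ∣ → ∃ λ v → isFirst S v ≡ true
  first-exists S 0<∣S∣ = first (order-statistic (lookup S) 0 (subst (0 <_) (∣∣≡count S) 0<∣S∣))
    where
    first : (∃ λ v → lookup S v ≡ true × count (λ w → lookup S w ∧ precedes σ w v) ≡ 0) →
            ∃ λ v → isFirst S v ≡ true
    first (v , v∈S , none) = v , ∧-intro v∈S (⌊⌋-true (count (λ w → lookup S w ∧ precedes σ w v) ≟ 0) none)

  module _ (v : Fin n) (R : Subset n) (v∉R : lookup R v ≡ false) where

    private
      S = R [ v ]≔ inside

      v∈S : lookup S v ≡ true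
      v∈S = lookup∘update v R inside

      S≐R : ∀ w → w ≢ v → lookup S w ≡ lookup R w
      S≐R w w≢v = lookup∘update′ w≢v R inside

      ∈R : ∀ {w} → w ∈ S → w ≢ v → w ∈ R
      ∈R {w} w∈S w≢v = lookup⇒[]= w R (trans (sym (S≐R w w≢v)) ([]=⇒lookup w∈S))

      neighbour : R ⊆ Nσ A σ v → ∀ {w} → w ∈ S → w ≢ v → A v w ≡ true × v ≺[ σ ] w
      neighbour R⊆N w∈S w≢v = ∈Nσ⁻ A σ (R⊆N (∈R w∈S w≢v))

    clique-of-neighbours : R ⊆ Nσ A σ v → IsClique A S
    clique-of-neighbours R⊆N u w u∈S w∈S u≢w with u Finₚ.≟ v | w Finₚ.≟ v
    ... | yes refl | yes refl = ⊥-elim (u≢w refl)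
    ... | yes refl | no w≢v = proj₁ (neighbour R⊆N w∈S w≢v)
    ... | no u≢v | yes refl = trans (proj₁ simple u w) (proj₁ (neighbour R⊆N u∈S u≢v))
    ... | no u≢v | no w≢v with avu , v≺u ← neighbour R⊆N u∈S u≢v | avw , v≺w ← neighbour R⊆N w∈S w≢v =
      peo v u w v≺u v≺w avu avw u≢w

    first-of-neighbours : R ⊆ Nσ A σ v → isFirst S v ≡ true
    first-of-neighbours R⊆N = ∧-intro v∈S
      (⌊⌋-true (count (λ w → lookup S w ∧ precedes σ w v) ≟ 0) (trans (count-cong none-before) (count-false {n})))
      where
      none-before : ∀ w → (lookup S w ∧ precedes σ w v) ≡ false
      none-before w with w Finₚ.≟ v
      ... | yes refl = trans (cong (lookup S w ∧_) (precedes-irrefl σ w)) (∧-zeroʳ (lookup S w))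
      ... | no w≢v with lookup S w in w∈?S
      ... | false = refl
      ... | true = precedes-asym σ (proj₂ (neighbour R⊆N (lookup⇒[]= w S w∈?S) w≢v))

    neighbours-of-first : IsClique A S → isFirst S v ≡ true → R ⊆ Nσ A σ v
    neighbours-of-first S-clique v-first {w} w∈R = ∈Nσ⁺ A σ
      (S-clique v w (lookup⇒[]= v S v∈S) w∈S (w≢v ∘ sym))
      (precedes-connex σ w≢v (trans (sym (∧-identityˡ (precedes σ w v)))
        (trans (cong (_∧ precedes σ w v) (sym ([]=⇒lookup w∈S))) (nothing-before S v v-first w))))
      where
      w≢v : w ≢ v
      w≢v refl = absurdᵇ ([]=⇒lookup w∈R) v∉R
      w∈S : w ∈ S
      w∈S = lookup⇒[]= w S (trans (S≐R w w≢v) ([]=⇒lookup w∈R))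

    first-decomposition : ∀ i →
      (isCliqueOfSize A S (suc i) ∧ isFirst S v) ≡ (⌊ R ⊆? Nσ A σ v ⌋ ∧ ⌊ ∣ R ∣ ≟ i ⌋)
    first-decomposition i = ⇔→≡ {z = true} (mk⇔ to from)
      where
      ∣S∣ = ∣[]≔inside∣ R v v∉R
      to : (isCliqueOfSize A S (suc i) ∧ isFirst S v) ≡ true → (⌊ R ⊆? Nσ A σ v ⌋ ∧ ⌊ ∣ R ∣ ≟ i ⌋) ≡ true
      to h = ∧-intro
        (⌊⌋-true (R ⊆? Nσ A σ v)
          (neighbours-of-first (⌊⌋⇒ (isClique? A S) (∧-conicalˡ ⌊ isClique? A S ⌋ ⌊ ∣ S ∣ ≟ suc i ⌋ cl))
                               (∧-conicalʳ (isCliqueOfSize A S (suc i)) (isFirst S v) h)))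
        (⌊⌋-true (∣ R ∣ ≟ i) (suc-injective (trans (sym ∣S∣)
          (⌊⌋⇒ (∣ S ∣ ≟ suc i) (∧-conicalʳ ⌊ isClique? A S ⌋ ⌊ ∣ S ∣ ≟ suc i ⌋ cl)))))
        where cl = ∧-conicalˡ (isCliqueOfSize A S (suc i)) (isFirst S v) h
      from : (⌊ R ⊆? Nσ A σ v ⌋ ∧ ⌊ ∣ R ∣ ≟ i ⌋) ≡ true → (isCliqueOfSize A S (suc i) ∧ isFirst S v) ≡ true
      from h = ∧-intro
        (∧-intro (⌊⌋-true (isClique? A S) (clique-of-neighbours R⊆N))
                 (⌊⌋-true (∣ S ∣ ≟ suc i) (trans ∣S∣ (cong suc (⌊⌋⇒ (∣ R ∣ ≟ i)
                   (∧-conicalʳ ⌊ R ⊆? Nσ A σ v ⌋ ⌊ ∣ R ∣ ≟ i ⌋ h))))))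
        (first-of-neighbours R⊆N)
        where R⊆N = ⌊⌋⇒ (R ⊆? Nσ A σ v) (∧-conicalˡ ⌊ R ⊆? Nσ A σ v ⌋ ⌊ ∣ R ∣ ≟ i ⌋ h)

  module _ (i : ℕ) where

    private
      K : Subset n → Bool
      K S = isCliqueOfSize A S (suc i)

    split-by-first : ∀ S → 𝟙[ K S ] ≡ count (λ v → K S ∧ isFirst S v)
    split-by-first S = sym (count≡𝟙 unique witness (λ v → ∧-conicalˡ (K S) (isFirst S v)))
      where
      unique : AtMostOne (λ v → K S ∧ isFirst S v)
      unique a b a-first b-first =
        first-unique S a b (∧-conicalʳ (K S) (isFirst S a) a-first) (∧-conicalʳ (K S) (isFirst S b) b-first)
      witness : K S ≡ true → ∃ λ v → (K S ∧ isFirst S v) ≡ true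
      witness KS = extend (first-exists S (subst (0 <_) (sym ∣S∣≡1+i) (s≤s z≤n)))
        where
        extend : (∃ λ v → isFirst S v ≡ true) → ∃ λ v → (K S ∧ isFirst S v) ≡ true
        extend (v , v-first) = v , ∧-intro KS v-first
        ∣S∣≡1+i : ∣ S ∣ ≡ suc i
        ∣S∣≡1+i = ⌊⌋⇒ (∣ S ∣ ≟ suc i) (∧-conicalʳ ⌊ isClique? A S ⌋ ⌊ ∣ S ∣ ≟ suc i ⌋ KS)

    cliques-with-first : ∀ v → ∑ˢ n (λ S → 𝟙[ K S ∧ isFirst S v ]) ≡ nσ A σ v C i
    cliques-with-first v = begin
      ∑ˢ n (λ S → 𝟙[ K S ∧ isFirst S v ])
        ≡⟨ ∑ˢ-cong n first-in-S ⟩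
      ∑ˢ n (λ S → if lookup S v then 𝟙[ K S ∧ isFirst S v ] else 0)
        ≡⟨ ∑ˢ-insert n v (λ S → 𝟙[ K S ∧ isFirst S v ]) ⟩
      ∑ˢ n (λ R → if lookup R v then 0 else 𝟙[ K (R [ v ]≔ inside) ∧ isFirst (R [ v ]≔ inside) v ])
        ≡⟨ ∑ˢ-cong n decompose ⟩
      ∑ˢ n (λ R → 𝟙[ ⌊ R ⊆? Nσ A σ v ⌋ ∧ ⌊ ∣ R ∣ ≟ i ⌋ ])
        ≡⟨ ∑ˢ-⊆-size n (Nσ A σ v) i ⟩
      nσ A σ v C i ∎
      where
      open ≡-Reasoning

      first-in-S : ∀ S → 𝟙[ K S ∧ isFirst S v ] ≡ (if lookup S v then 𝟙[ K S ∧ isFirst S v ] else 0)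
      first-in-S S with lookup S v
      ... | true = refl
      ... | false = cong 𝟙[_] (∧-zeroʳ (K S))

      decompose : ∀ R → (if lookup R v then 0 else 𝟙[ K (R [ v ]≔ inside) ∧ isFirst (R [ v ]≔ inside) v ]) ≡
                        𝟙[ ⌊ R ⊆? Nσ A σ v ⌋ ∧ ⌊ ∣ R ∣ ≟ i ⌋ ]
      decompose R with lookup R v in v∈?R
      ... | false = cong 𝟙[_] (first-decomposition v R v∈?R i)
      ... | true = cong (λ b → 𝟙[ b ∧ ⌊ ∣ R ∣ ≟ i ⌋ ]) (sym (⌊⌋-false (R ⊆? Nσ A σ v) R⊈N))
        where
        R⊈N : ¬ R ⊆ Nσ A σ v
        R⊈N R⊆N = <-irrefl refl (proj₂ (∈Nσ⁻ A σ (R⊆N (lookup⇒[]= v R v∈?R))))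

  cliqueCount≡∑C : ∀ i → cliqueCount A (suc i) ≡ ∑[ v < n ] (nσ A σ v C i)
  cliqueCount≡∑C i = begin
    cliqueCount A (suc i)                                         ≡⟨ cliqueCount≡∑ˢ A (suc i) ⟩
    ∑ˢ n (λ S → 𝟙[ K S ])                                         ≡⟨ ∑ˢ-cong n (split-by-first i) ⟩
    ∑ˢ n (λ S → ∑[ v < n ] 𝟙[ K S ∧ isFirst S v ])                ≡⟨ ∑ˢ-comm n (λ v S → 𝟙[ K S ∧ isFirst S v ]) ⟩
    ∑[ v < n ] ∑ˢ n (λ S → 𝟙[ K S ∧ isFirst S v ])                ≡⟨ sum-cong-≗ (cliques-with-first i) ⟩
    ∑[ v < n ] (nσ A σ v C i)                                     ∎
    where
    open ≡-Reasoning
    K : Subset n → Bool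
    K S = isCliqueOfSize A S (suc i)

  ∉Nσ-self : ∀ v → lookup (Nσ A σ v) v ≡ false
  ∉Nσ-self v = ¬-not λ v∈N → <-irrefl refl (proj₂ (∈Nσ⁻ A σ (lookup⇒[]= v (Nσ A σ v) v∈N)))

  closed-neighbourhood-clique : ∀ v → IsClique A (Nσ A σ v [ v ]≔ inside)
  closed-neighbourhood-clique v = clique-of-neighbours v (Nσ A σ v) (∉Nσ-self v) (λ w∈N → w∈N)

  ∣closed-neighbourhood∣ : ∀ v → ∣ Nσ A σ v [ v ]≔ inside ∣ ≡ suc (nσ A σ v)
  ∣closed-neighbourhood∣ v = ∣[]≔inside∣ (Nσ A σ v) v (∉Nσ-self v)

-- The graph α_σ(G)

module AlphaGraph {n d} (adj : Adj n) (x : Fin d → Fin n) (σ : Permutation′ n)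
  (simple : Simple adj) (x-injective : ∀ i j → x i ≡ x j → i ≡ j)
  (K-clique : IsClique adj (cliqueSet x)) (K-last : ∀ u v → ¬ InK x u → InK x v → u ≺[ σ ] v)
  (nσ<d : ∀ v → nσ adj σ v < d) where

  T : Adj n
  T = αGraph adj x σ

  inK-x : ∀ i → inK x (x i) ≡ true
  inK-x i = ⌊⌋-true (Finₚ.any? λ j → x i Finₚ.≟ x j) (i , refl)

  inK⇒ : ∀ {v} → inK x v ≡ true → ∃ λ i → v ≡ x i
  inK⇒ {v} = ⌊⌋⇒ (Finₚ.any? λ j → v Finₚ.≟ x j)

  K-adjacent : ∀ {u v} → inK x u ≡ true → inK x v ≡ true → u ≢ v → adj u v ≡ true
  K-adjacent u∈K v∈K = K-clique _ _ (∈-tabulate⁺ u∈K) (∈-tabulate⁺ v∈K)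

  K-upward : ∀ {u v} → inK x u ≡ true → u ≺[ σ ] v → inK x v ≡ true
  K-upward {u} {v} u∈K u≺v = ¬-not {y = false} λ v∉K →
    <-asym u≺v (K-last v u (λ v∈K → absurdᵇ v∈K v∉K) u∈K)

  data αEdge (a b : Fin n) : Set where
    within-K : inK x a ≡ true → inK x b ≡ true → a ≢ b → αEdge a b
    into-K : inK x a ≡ false → ∀ i → b ≡ x i → toℕ i < nσ adj σ a → αEdge a b
    from-K : inK x b ≡ false → ∀ i → a ≡ x i → toℕ i < nσ adj σ b → αEdge a b

  αEdge-sym : ∀ {a b} → αEdge a b → αEdge b a
  αEdge-sym (within-K a∈K b∈K a≢b) = within-K b∈K a∈K (a≢b ∘ sym)
  αEdge-sym (into-K a∉K i b≡xi i<k) = from-K a∉K i b≡xi i<k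
  αEdge-sym (from-K b∉K i a≡xi i<k) = into-K b∉K i a≡xi i<k

  αEdge-irrefl : ∀ {a} → ¬ αEdge a a
  αEdge-irrefl (within-K _ _ a≢a) = a≢a refl
  αEdge-irrefl (into-K a∉K i refl _) = absurdᵇ (inK-x i) a∉K
  αEdge-irrefl (from-K a∉K i refl _) = absurdᵇ (inK-x i) a∉K

  later : Fin n → Fin n → Bool
  later a w = adj a w ∧ precedes σ a w

  rankσ≡count : ∀ a v → rankσ adj σ a v ≡ count (λ w → later a w ∧ precedes σ w v)
  rankσ≡count a v = trans (∣tabulate∣≡count (λ w → adj a w ∧ precedes σ a w ∧ precedes σ w v))
    (count-cong λ w → sym (∧-assoc (adj a w) (precedes σ a w) (precedes σ w v)))

  rankσ<nσ : ∀ a v → later a v ≡ true → rankσ adj σ a v < nσ adj σ a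
  rankσ<nσ a v av = subst₂ _<_ (sym (rankσ≡count a v)) (sym (∣tabulate∣≡count (later a)))
    (count-mono-< (λ w → ∧-conicalˡ (later a w) (precedes σ w v)) v
      (trans (cong (later a v ∧_) (precedes-irrefl σ v)) (∧-zeroʳ (later a v))) av)

  open OrderStatistic (posℕ σ) (posℕ-injective σ) using (order-statistic)

  neighbour-of-rank : ∀ a r → r < nσ adj σ a → ∃ λ v → later a v ≡ true × rankσ adj σ a v ≡ r
  neighbour-of-rank a r r<k =
    with-rank (order-statistic (later a) r (subst (r <_) (∣tabulate∣≡count (later a)) r<k))
    where
    with-rank : (∃ λ v → later a v ≡ true × count (λ w → later a w ∧ precedes σ w v) ≡ r) →
                ∃ λ v → later a v ≡ true × rankσ adj σ a v ≡ r
    with-rank (v , av , #before≡r) = v , av , trans (rankσ≡count a v) #before≡r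

  private
    inner : Fin n → Fin n → Fin n → Fin n → Bool
    inner u v a b = inK x u ∧ inK x v ∧ eqᵇ a u ∧ eqᵇ b v

    outer : Fin n → Fin n → Fin n → Fin n → Bool
    outer u v a b = not (inK x u) ∧ adj u v ∧ precedes σ u v ∧ eqᵇ a u ∧
                    anyL (λ i → (rankσ adj σ u v ≡ᵇ toℕ i) ∧ eqᵇ b (x i)) (allFin d)

    inner⇒ : ∀ u v a b → inner u v a b ≡ true → inK x u ≡ true × inK x v ≡ true × a ≡ u × b ≡ v
    inner⇒ u v a b h =
      let u∈K , h₁ = ∧-elim (inK x u) h
          v∈K , h₂ = ∧-elim (inK x v) h₁
          a≡u , b≡v = ∧-elim (eqᵇ a u) h₂
      in u∈K , v∈K , eqᵇ⇒≡ a u a≡u , eqᵇ⇒≡ b v b≡v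

    outer⇒ : ∀ u v a b → outer u v a b ≡ true →
             inK x u ≡ false × later u v ≡ true × a ≡ u × ∃ λ i → b ≡ x i × rankσ adj σ u v ≡ toℕ i
    outer⇒ u v a b h =
      let u∉K , h₁ = ∧-elim (not (inK x u)) h
          uv , h₂ = ∧-elim (adj u v) h₁
          u≺v , h₃ = ∧-elim (precedes σ u v) h₂
          a≡u , h₄ = ∧-elim (eqᵇ a u) h₃
          i , h₅ = any-tabulate⁻ (λ i → (rankσ adj σ u v ≡ᵇ toℕ i) ∧ eqᵇ b (x i)) id h₄
          rank≡i , b≡xi = ∧-elim (rankσ adj σ u v ≡ᵇ toℕ i) h₅
      in ¬-not {y = true} (λ u∈K → case trans (sym (cong not u∈K)) u∉K of λ ()) , ∧-intro uv u≺v ,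
         eqᵇ⇒≡ a u a≡u , i , eqᵇ⇒≡ b (x i) b≡xi , ≡ᵇ-true⇒≡ (rankσ adj σ u v) (toℕ i) rank≡i

  αMaps⇒αEdge : ∀ u v a b → adj u v ≡ true → αMaps adj x σ u v a b ≡ true → αEdge a b
  αMaps⇒αEdge u v a b uv maps with ∨-elim (inner u v a b) maps
  ... | inj₁ inn with u∈K , v∈K , refl , refl ← inner⇒ u v a b inn =
    within-K u∈K v∈K λ { refl → absurdᵇ uv (proj₂ simple u) }
  ... | inj₂ out with u∉K , uv′ , refl , i , b≡xi , rank≡i ← outer⇒ u v a b out =
    into-K u∉K i b≡xi (subst (_< nσ adj σ u) rank≡i (rankσ<nσ u v uv′))

  maps-into-K : ∀ {a b} → inK x a ≡ false → ∀ i → b ≡ x i → toℕ i < nσ adj σ a →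
                ∃ λ v → adj a v ≡ true × αMaps adj x σ a v a b ≡ true
  maps-into-K {a} {b} a∉K i b≡xi i<k = with-rank (neighbour-of-rank a (toℕ i) i<k)
    where
    with-rank : (∃ λ v → later a v ≡ true × rankσ adj σ a v ≡ toℕ i) →
                ∃ λ v → adj a v ≡ true × αMaps adj x σ a v a b ≡ true
    with-rank (v , av , rank≡i) = v , ∧-conicalˡ (adj a v) (precedes σ a v) av ,
      ∨-introʳ (inner a v a b) (∧-intro (cong not a∉K) (∧-intro (∧-conicalˡ (adj a v) (precedes σ a v) av)
        (∧-intro (∧-conicalʳ (adj a v) (precedes σ a v) av) (∧-intro (eqᵇ-refl a)
          (any-tabulate⁺ (λ j → (rankσ adj σ a v ≡ᵇ toℕ j) ∧ eqᵇ b (x j)) id i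
            (∧-intro (≡⇒≡ᵇ-true (rankσ adj σ a v) (toℕ i) rank≡i) (⌊⌋-true (b Finₚ.≟ x i) b≡xi)))))))

  private
    maps-either : Fin n → Fin n → Fin n → Fin n → Bool
    maps-either a b u v = adj u v ∧ (αMaps adj x σ u v a b ∨ αMaps adj x σ u v b a)

  αGraph-intro : ∀ a b u v → maps-either a b u v ≡ true → T a b ≡ true
  αGraph-intro a b u v m = any-tabulate⁺ (λ u → anyL (maps-either a b u) (allFin n)) id u
                             (any-tabulate⁺ (maps-either a b u) id v m)

  maps⇒αGraph : ∀ {a b} → (∃ λ v → adj a v ≡ true × αMaps adj x σ a v a b ≡ true) →
                T a b ≡ true × T b a ≡ true
  maps⇒αGraph {a} {b} (v , av , maps) =
    αGraph-intro a b a v (∧-intro av (∨-introˡ (αMaps adj x σ a v b a) maps)) ,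
    αGraph-intro b a a v (∧-intro av (∨-introʳ (αMaps adj x σ a v b a) maps))

  αEdge⇒αGraph : ∀ {a b} → αEdge a b → T a b ≡ true
  αEdge⇒αGraph {a} {b} (within-K a∈K b∈K a≢b) = αGraph-intro a b a b
    (∧-intro (K-adjacent a∈K b∈K a≢b) (∨-introˡ (αMaps adj x σ a b b a) (∨-introˡ (outer a b a b)
      (∧-intro a∈K (∧-intro b∈K (∧-intro (eqᵇ-refl a) (eqᵇ-refl b)))))))
  αEdge⇒αGraph (into-K a∉K i b≡xi i<k) = proj₁ (maps⇒αGraph (maps-into-K a∉K i b≡xi i<k))
  αEdge⇒αGraph (from-K b∉K i a≡xi i<k) = proj₂ (maps⇒αGraph (maps-into-K b∉K i a≡xi i<k))

  αGraph⇒αEdge : ∀ {a b} → T a b ≡ true → αEdge a b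
  αGraph⇒αEdge {a} {b} Tab
    with u , any-v ← any-tabulate⁻ (λ u → anyL (maps-either a b u) (allFin n)) id Tab
    with v , m ← any-tabulate⁻ (maps-either a b u) id any-v
    with uv , maps ← ∧-elim (adj u v) m
    with ∨-elim (αMaps adj x σ u v a b) maps
  ... | inj₁ maps-ab = αMaps⇒αEdge u v a b uv maps-ab
  ... | inj₂ maps-ba = αEdge-sym (αMaps⇒αEdge u v b a uv maps-ba)

  αGraph-simple : Simple T
  αGraph-simple = (λ a b → ⇔→≡ {z = true} (mk⇔ flip flip)) , (λ a → ¬-not (αEdge-irrefl ∘ αGraph⇒αEdge))
    where
    flip : ∀ {a b} → T a b ≡ true → T b a ≡ true
    flip = αEdge⇒αGraph ∘ αEdge-sym ∘ αGraph⇒αEdge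

  later-αEdge-in-K : ∀ {v u} → v ≺[ σ ] u → αEdge v u → inK x u ≡ true
  later-αEdge-in-K _ (within-K _ u∈K _) = u∈K
  later-αEdge-in-K _ (into-K _ i refl _) = inK-x i
  later-αEdge-in-K v≺u (from-K u∉K i refl _) = absurdᵇ (K-upward (inK-x i) v≺u) u∉K

  αGraph-peo : IsPEO T σ
  αGraph-peo v u w v≺u v≺w Tvu Tvw u≢w = αEdge⇒αGraph
    (within-K (later-αEdge-in-K v≺u (αGraph⇒αEdge Tvu)) (later-αEdge-in-K v≺w (αGraph⇒αEdge Tvw)) u≢w)

  nσ-αGraph-K : ∀ v → inK x v ≡ true → nσ T σ v ≡ nσ adj σ v
  nσ-αGraph-K v v∈K = trans (∣tabulate∣≡count (λ w → T v w ∧ precedes σ v w))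
    (trans (count-cong same-later) (sym (∣tabulate∣≡count (later v))))
    where
    same-later : ∀ w → (T v w ∧ precedes σ v w) ≡ later v w
    same-later w with precedes σ v w in v≺?w
    ... | false = trans (∧-zeroʳ (T v w)) (sym (∧-zeroʳ (adj v w)))
    ... | true = trans (∧-identityʳ (T v w)) (trans (trans Tvw (sym avw)) (sym (∧-identityʳ (adj v w))))
      where
      v≺w = ⌊⌋⇒ (pos σ v Finₚ.<? pos σ w) v≺?w
      v≢w : v ≢ w
      v≢w refl = <-irrefl refl v≺w
      w∈K = K-upward v∈K v≺w
      Tvw = αEdge⇒αGraph (within-K v∈K w∈K v≢w)
      avw = K-adjacent v∈K w∈K v≢w

  nσ-αGraph-outside-K : ∀ v → inK x v ≡ false → nσ T σ v ≡ nσ adj σ v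
  nσ-αGraph-outside-K v v∉K = begin
    nσ T σ v                                       ≡⟨ ∣tabulate∣≡count (λ w → T v w ∧ precedes σ v w) ⟩
    count (λ w → T v w ∧ precedes σ v w)           ≡⟨ sum-cong-≗ (λ w → sym (as-count w)) ⟩
    ∑[ w < n ] count (λ i → hits w i)              ≡⟨ ∑-comm (λ w i → 𝟙[ hits w i ]) ⟩
    ∑[ i < d ] count (λ w → hits w i)              ≡⟨ sum-cong-≗ (λ i → count-eqᵇ (x i) ⌊ toℕ i <? k ⌋) ⟩
    count {d} (λ i → ⌊ toℕ i <? k ⌋)               ≡⟨ count-< k (<⇒≤ (nσ<d v)) ⟩
    k                                              ∎
    where
    open ≡-Reasoning
    k = nσ adj σ v

    hits : Fin n → Fin d → Bool
    hits w i = eqᵇ w (x i) ∧ ⌊ toℕ i <? k ⌋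

    as-count : ∀ w → count (λ i → hits w i) ≡ 𝟙[ T v w ∧ precedes σ v w ]
    as-count w = count≡𝟙 unique witness sound
      where
      unique : AtMostOne (hits w)
      unique i j p q = x-injective i j (trans (sym (eqᵇ⇒≡ w (x i) (∧-conicalˡ (eqᵇ w (x i)) _ p)))
                                              (eqᵇ⇒≡ w (x j) (∧-conicalˡ (eqᵇ w (x j)) _ q)))
      witness′ : αEdge v w → ∃ λ i → hits w i ≡ true
      witness′ (within-K v∈K _ _) = absurdᵇ v∈K v∉K
      witness′ (into-K _ i w≡xi i<k) = i , ∧-intro (⌊⌋-true (w Finₚ.≟ x i) w≡xi) (⌊⌋-true (toℕ i <? k) i<k)
      witness′ (from-K _ i refl _) = absurdᵇ (inK-x i) v∉K
      witness : (T v w ∧ precedes σ v w) ≡ true → ∃ λ i → hits w i ≡ true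
      witness p = witness′ (αGraph⇒αEdge (∧-conicalˡ (T v w) (precedes σ v w) p))
      sound : ∀ i → hits w i ≡ true → (T v w ∧ precedes σ v w) ≡ true
      sound i p = ∧-intro (αEdge⇒αGraph (into-K v∉K i w≡xi (⌊⌋⇒ (toℕ i <? k) (∧-conicalʳ (eqᵇ w (x i)) _ p))))
        (⌊⌋-true (pos σ v Finₚ.<? pos σ w) (K-last v w (λ v∈K → absurdᵇ v∈K v∉K) (subst (InK x) (sym w≡xi) (inK-x i))))
        where w≡xi = eqᵇ⇒≡ w (x i) (∧-conicalˡ (eqᵇ w (x i)) _ p)

  nσ-αGraph : ∀ v → nσ T σ v ≡ nσ adj σ v
  nσ-αGraph v = by-cases (inK x v) (nσ-αGraph-K v) (nσ-αGraph-outside-K v)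

  d≤n : d ≤ n
  d≤n = Finₚ.injective⇒≤ λ {i} {j} → x-injective i j

  module _ (x-pos : ∀ i → toℕ (pos σ (x i)) ≡ n ∸ suc (toℕ i)) where

    private
      half< : ∀ {p q} → suc (2 * p) ≤ 2 * q → p < q
      half< {p} {q} le = ≰⇒> λ q≤p → 1+n≰n (≤-trans le (*-mono-≤ (≤-refl {2}) q≤p))

      half≤ : ∀ {p q} → 2 * p ≤ suc (2 * q) → p ≤ q
      half≤ {p} {q} le = ≮⇒≥ λ q<p →
        1+n≰n (≤-trans (≤-trans (≤-reflexive (sym (*-suc 2 q))) (*-mono-≤ (≤-refl {2}) q<p)) le)

    -- x i gets key 2(n-1-i) and a vertex v ∉ K with k later neighbours gets 2(n-1-k)+1,
    -- so v comes right after x k, i.e. after exactly the x i it is not joined to in T.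
    key : Fin n → ℕ
    key v = if inK x v then 2 * posℕ σ v else suc (2 * (n ∸ suc (nσ adj σ v)))

    key-K : ∀ {i v} → v ≡ x i → key v ≡ 2 * (n ∸ suc (toℕ i))
    key-K {i} refl = trans (cong (λ b → if b then _ else _) (inK-x i)) (cong (2 *_) (x-pos i))

    key-outside-K : ∀ {v} → inK x v ≡ false → key v ≡ suc (2 * (n ∸ suc (nσ adj σ v)))
    key-outside-K v∉K = cong (λ b → if b then _ else _) v∉K

    dominating-or-isolated : ∀ a → (∀ b → b ≢ a → key b ≤ key a → T a b ≡ true) ⊎
                                   (∀ b → key b ≤ key a → T a b ≡ false)
    dominating-or-isolated a = by-cases (inK x a)
      (λ a∈K → inj₁ λ b b≢a kb≤ka → αEdge⇒αGraph (by-cases (inK x b)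
        (λ b∈K → within-K a∈K b∈K (b≢a ∘ sym))
        (λ b∉K → let i , a≡xi = inK⇒ a∈K in from-K b∉K i a≡xi (≤-pred (∸-cancelʳ-< {o = n}
          (half< (subst₂ _≤_ (key-outside-K b∉K) (key-K a≡xi) kb≤ka)))))))
      (λ a∉K → inj₂ λ b kb≤ka → ¬-not λ Tab → no-edge a∉K b (αGraph⇒αEdge Tab) kb≤ka)
      where
      no-edge : inK x a ≡ false → ∀ b → αEdge a b → key b ≤ key a → ⊥
      no-edge a∉K b (within-K a∈K _ _) _ = absurdᵇ a∈K a∉K
      no-edge a∉K b (from-K _ i refl _) _ = absurdᵇ (inK-x i) a∉K
      no-edge a∉K b (into-K _ i b≡xi i<k) kb≤ka = <⇒≱
        (∸-monoʳ-< (s≤s i<k) (≤-trans (nσ<d a) d≤n))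
        (half≤ (subst₂ _≤_ (key-K b≡xi) (key-outside-K a∉K) kb≤ka))

    αGraph-threshold : 1 ≤ n → IsThreshold T
    αGraph-threshold 1≤n = threshold-by-key T αGraph-simple 1≤n key dominating-or-isolated

-- Graphs with the same clique counts

cliqueCount-pos : ∀ {n} (A : Adj n) S → IsClique A S → 0 < cliqueCount A ∣ S ∣
cliqueCount-pos {n} A S S-clique = subst (0 <_) (sym (cliqueCount≡∑ˢ A ∣ S ∣))
  (<-≤-trans (subst (λ b → 0 < 𝟙[ b ]) (sym S-counted) (s≤s z≤n)) (≤-∑ˢ n (λ R → 𝟙[ isCliqueOfSize A R ∣ S ∣ ]) S))
  where
  S-counted : isCliqueOfSize A S ∣ S ∣ ≡ true
  S-counted = ∧-intro (⌊⌋-true (isClique? A S) S-clique) (⌊⌋-true (∣ S ∣ ≟ ∣ S ∣) refl)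

cliqueCount-pos⁻ : ∀ {n} (A : Adj n) m → 0 < cliqueCount A m → ∃ λ S → IsClique A S × ∣ S ∣ ≡ m
cliqueCount-pos⁻ {n} A m 0<c = counted (∑ˢ-pos n _ (subst (0 <_) (cliqueCount≡∑ˢ A m) 0<c))
  where
  counted : (∃ λ S → 0 < 𝟙[ isCliqueOfSize A S m ]) → ∃ λ S → IsClique A S × ∣ S ∣ ≡ m
  counted (S , 0<𝟙) with isCliqueOfSize A S m in S-counted
  ... | true = S , ⌊⌋⇒ (isClique? A S) (∧-conicalˡ ⌊ isClique? A S ⌋ ⌊ ∣ S ∣ ≟ m ⌋ S-counted)
                 , ⌊⌋⇒ (∣ S ∣ ≟ m) (∧-conicalʳ ⌊ isClique? A S ⌋ ⌊ ∣ S ∣ ≟ m ⌋ S-counted)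

module _ {n} (A B : Adj n) (same-counts : ∀ i → 1 ≤ i → cliqueCount A i ≡ cliqueCount B i) where

  clique-transfer : ∀ S → IsClique A S → ∃ λ S′ → IsClique B S′ × ∣ S′ ∣ ≡ ∣ S ∣
  clique-transfer S S-clique with ∣ S ∣ in ∣S∣≡m
  ... | zero = ∅ , (λ u _ u∈∅ → ⊥-elim (∉⊥ u∈∅)) , ∣⊥∣≡0 n
  ... | suc m = cliqueCount-pos⁻ B (suc m)
    (subst (0 <_) (same-counts (suc m) (s≤s z≤n)) (subst (λ k → 0 < cliqueCount A k) ∣S∣≡m (cliqueCount-pos A S S-clique)))

  CliqueNumber-transfer : ∀ {d} → CliqueNumber A d → CliqueNumber B d
  CliqueNumber-transfer {d} ((S , S-clique , ∣S∣≡d) , bounded) =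
    (let S′ , S′-clique , ∣S′∣≡∣S∣ = clique-transfer S S-clique in S′ , S′-clique , trans ∣S′∣≡∣S∣ ∣S∣≡d) ,
    λ S S-clique → B-bounded S S-clique
    where
    B-bounded : ∀ S → IsClique B S → ∣ S ∣ ≤ d
    B-bounded S S-clique with ∣ S ∣ in ∣S∣≡m
    ... | zero = z≤n
    ... | suc m with S′ , S′-clique , ∣S′∣≡1+m ← cliqueCount-pos⁻ A (suc m)
          (subst (0 <_) (sym (same-counts (suc m) (s≤s z≤n))) (subst (λ k → 0 < cliqueCount B k) ∣S∣≡m (cliqueCount-pos B S S-clique)))
          = subst (_≤ d) ∣S′∣≡1+m (bounded S′ S′-clique)

  IsBVector-transfer : ∀ d (b : Vec ℤ d) → IsBVector A d b ⇔ IsBVector B d b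
  IsBVector-transfer d b = mk⇔ (λ bA y → trans (bA y) (cong (λ c → evalPoly (Vec.map +_ c) y) same-vector))
                              (λ bB y → trans (bB y) (cong (λ c → evalPoly (Vec.map +_ c) y) (sym same-vector)))
    where
    same-vector : cliqueVector A d ≡ cliqueVector B d
    same-vector = tabulate-cong λ k → same-counts (suc (toℕ k)) (s≤s z≤n)

theorem5p5 : ∀ (n d : ℕ) (adj : Adj n) → Simple adj → Chordal adj → NonComplete adj →
    CliqueNumber adj d →
    (x : Fin d → Fin n) → (∀ i j → x i ≡ x j → i ≡ j) → IsClique adj (cliqueSet x) →
    (σ : Permutation′ n) → Admissible adj x σ →
    IsThreshold (αGraph adj x σ) ×
    (∀ i → 1 ≤ i → cliqueCount adj i ≡ cliqueCount (αGraph adj x σ) i) ×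
    CliqueNumber (αGraph adj x σ) d ×
    (∀ (b : Vec ℤ d) → IsBVector adj d b ⇔ IsBVector (αGraph adj x σ) d b)
theorem5p5 n d adj simple _ (u , _) clique-number x x-injective K-clique σ (peo , (K-last , x-pos) , _) =
  αGraph-threshold x-pos (1≤n u) , same-counts ,
  CliqueNumber-transfer adj T same-counts clique-number , IsBVector-transfer adj T same-counts d
  where
  open PEOCliques adj σ simple peo

  nσ<d : ∀ v → nσ adj σ v < d
  nσ<d v = subst (_≤ d) (∣closed-neighbourhood∣ v) (proj₂ clique-number _ (closed-neighbourhood-clique v))

  open AlphaGraph adj x σ simple x-injective K-clique K-last nσ<d
  module T-cliques = PEOCliques T σ αGraph-simple αGraph-peo

  1≤n : Fin n → 1 ≤ n
  1≤n zero = s≤s z≤n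
  1≤n (suc _) = s≤s z≤n

  same-counts : ∀ i → 1 ≤ i → cliqueCount adj i ≡ cliqueCount T i
  same-counts (suc i) _ = begin
    cliqueCount adj (suc i)      ≡⟨ cliqueCount≡∑C i ⟩
    ∑[ v < n ] (nσ adj σ v C i)  ≡⟨ sum-cong-≗ (λ v → cong (_C i) (sym (nσ-αGraph v))) ⟩
    ∑[ v < n ] (nσ T σ v C i)    ≡⟨ T-cliques.cliqueCount≡∑C i ⟨
    cliqueCount T (suc i)        ∎
    where open ≡-Reasoning
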